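{- Let $n\ge1$ and let $X$ be a relational team over $\mathrm{Var}^h_n$. Then $X\models\mathrm{Loc}^h_n$ if and only if the following condition (*) holds: for every $(\bar a,c)\in X(\bar m,\lambda)$ and all $b_1,\dots,b_n$ with $b_i\in X(o_i)$, if for every $i\le n$ there is an assignment $s_i\in X$ with $s_i(m_i,o_i,\lambda)=(a_i,b_i,c)$, then there is $s\in X$ with $s(\bar m,\bar o,\lambda)=(\bar a,\bar b,c)$.
   Context: A (relational) team $X$ is a set of assignments $s\colon D\to A$ with common finite domain $D$; for a tuple of variables $\bar x$, $X(\bar x)=\{s(\bar x):s\in X\}$. Independence atom: $X\models\bar x\perp_{\bar z}\bar y$ iff for all $s,s'\in X$ with $s(\bar z)=s'(\bar z)$ there exists $s''\in X$ with $s''(\bar z)=s(\bar z)$, $s''(\bar x)=s(\bar x)$, $s''(\bar y)=s'(\bar y)$; a conjunction holds iff each conjunct holds. $\mathrm{Var}^h_n=\{m_1,\dots,m_n,o_1,\dots,o_n,\lambda\}$, $\bar m=(m_1,\dots,m_n)$, $\bar o=(o_1,\dots,o_n)$, and $\bar z_{ -i}$ denotes the tuple $\bar z$ with the $i$-th entry removed. Define $\text{Out-Indep}^h_n:=\bigwedge_{i=1}^n o_i\perp_{\bar m\lambda}\bar o_{ -i}$, $\text{Par-Indep}^h_n:=\bigwedge_{i=1}^n o_i\perp_{m_i\lambda}\bar m_{ -i}$, and $\mathrm{Loc}^h_n:=\text{Out-Indep}^h_n\land\text{Par-Indep}^h_n$. -}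

module Defs where

open import Data.Nat using (ℕ)
open import Data.Fin using (Fin; _≟_)
open import Data.List using (List; map; filter; allFin; _∷_; [])
open import Data.List.Relation.Unary.All using (All)
open import Data.Product using (Σ; _×_; ∃)
open import Relation.Nullary using (¬?)
open import Relation.Binary.PropositionalEquality using (_≡_)

data Var (n : ℕ) : Set where
  m : Fin n → Var n
  o : Fin n → Var n
  lam : Var n

Assignment : ℕ → Set → Set
Assignment n A = Var n → A

Team : ℕ → Set → Set₁
Team n A = Assignment n A → Set

Agree : {n : ℕ} {A : Set} → List (Var n) → Assignment n A → Assignment n A → Set
Agree zs s s' = All (λ v → s v ≡ s' v) zs

-- independence atom  X ⊨ x̄ ⊥_z̄ ȳ
Indep : {n : ℕ} {A : Set} → Team n A → List (Var n) → List (Var n) → List (Var n) → Set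
Indep X xs zs ys =
  ∀ s s' → X s → X s' → Agree zs s s' →
  Σ _ λ s'' → X s'' × Agree zs s'' s × Agree xs s'' s × Agree ys s'' s'

m̄ : (n : ℕ) → List (Var n)
m̄ n = map m (allFin n)

ō : (n : ℕ) → List (Var n)
ō n = map o (allFin n)

others : (n : ℕ) → Fin n → List (Fin n)
others n i = filter (λ j → ¬? (j ≟ i)) (allFin n)

m̄₋ : (n : ℕ) → Fin n → List (Var n)
m̄₋ n i = map m (others n i)

ō₋ : (n : ℕ) → Fin n → List (Var n)
ō₋ n i = map o (others n i)

m̄λ : (n : ℕ) → List (Var n)
m̄λ n = Data.List._++_ (m̄ n) (lam ∷ [])

OutIndep : {n : ℕ} {A : Set} → Team n A → Set
OutIndep {n} X = ∀ (i : Fin n) → Indep X (o i ∷ []) (m̄λ n) (ō₋ n i)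

ParIndep : {n : ℕ} {A : Set} → Team n A → Set
ParIndep {n} X = ∀ (i : Fin n) → Indep X (o i ∷ []) (m i ∷ lam ∷ []) (m̄₋ n i)

Loc : {n : ℕ} {A : Set} → Team n A → Set
Loc X = OutIndep X × ParIndep X

Star : {n : ℕ} {A : Set} → Team n A → Set
Star {n} {A} X =
  (a : Fin n → A) (c : A) →
  (Σ _ λ t → X t × (∀ i → t (m i) ≡ a i) × t lam ≡ c) →
  (b : Fin n → A) →
  (∀ i → Σ _ λ t → X t × t (o i) ≡ b i) →
  (∀ i → Σ _ λ sᵢ → X sᵢ × sᵢ (m i) ≡ a i × sᵢ (o i) ≡ b i × sᵢ lam ≡ c) →
  Σ _ λ s → X s × (∀ i → s (m i) ≡ a i × s (o i) ≡ b i) × s lam ≡ c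

-- Both Loc and (*) are equivalent to the exchange property: whenever s, s' ∈ X
-- agree on m_i and λ, the team contains s' with its i-th output replaced by that
-- of s.  Par-Indep followed by Out-Indep performs such an exchange; conversely
-- each of the two atoms is a single exchange.  Starting from a witness of
-- (ā, c), n exchanges install the outputs b_i of the s_i one at a time, which
-- gives (*); and (*) applied to the inputs (m̄, λ) of s' and the outputs of s'
-- with the i-th one taken from s yields the exchange directly.
module Submission where

open import Defs
open import Data.Nat using (ℕ; _≤_)
open import Data.Fin using (Fin; _≟_)
open import Data.List using (List; map; allFin; _∷_; [])
open import Data.List.Relation.Unary.All as All using (All; _∷_; [])
open import Data.List.Relation.Unary.All.Properties using (map⁺; map⁻; ++⁺; ++⁻ˡ; ++⁻ʳ)
open import Data.List.Membership.Propositional using (_∈_)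
open import Data.List.Membership.Propositional.Properties using (∈-filter⁺; ∈-filter⁻; ∈-allFin)
open import Data.Product using (Σ; _×_; _,_; proj₁; proj₂)
open import Data.Vec.Functional using (updateAt)
open import Data.Vec.Functional.Properties using (updateAt-updates; updateAt-minimal)
open import Function.Bundles using (_⇔_; mk⇔)
open import Relation.Nullary using (¬?; yes; no)
open import Relation.Binary.PropositionalEquality using (_≡_; _≢_; refl; sym; trans)

module _ {n : ℕ} {A : Set} where

  agree-map⁺ : {B : Set} {f : B → Var n} {xs : List B} {s s' : Assignment n A} →
               (∀ {j} → j ∈ xs → s (f j) ≡ s' (f j)) → Agree (map f xs) s s'
  agree-map⁺ eq = map⁺ (All.tabulate eq)

  agree-map⁻ : {B : Set} {f : B → Var n} {xs : List B} {s s' : Assignment n A} →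
               Agree (map f xs) s s' → ∀ {j} → j ∈ xs → s (f j) ≡ s' (f j)
  agree-map⁻ agree = All.lookup (map⁻ agree)

  ∈-others⁺ : ∀ {i j} → j ≢ i → j ∈ others n i
  ∈-others⁺ {i} {j} j≢i = ∈-filter⁺ (λ k → ¬? (k ≟ i)) (∈-allFin j) j≢i

  ∈-others⁻ : ∀ {i j} → j ∈ others n i → j ≢ i
  ∈-others⁻ {i} j∈ = proj₂ (∈-filter⁻ (λ k → ¬? (k ≟ i)) {xs = allFin n} j∈)

  agree-others⁺ : ∀ {i} {f : Fin n → Var n} {s s' : Assignment n A} →
                  (∀ j → j ≢ i → s (f j) ≡ s' (f j)) → Agree (map f (others n i)) s s'
  agree-others⁺ eq = agree-map⁺ (λ {j} j∈ → eq j (∈-others⁻ j∈))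

  agree-others⁻ : ∀ {i} {f : Fin n → Var n} {s s' : Assignment n A} →
                  Agree (map f (others n i)) s s' → ∀ j → j ≢ i → s (f j) ≡ s' (f j)
  agree-others⁻ agree j j≢i = agree-map⁻ agree (∈-others⁺ j≢i)

  agree-others-and-at : ∀ {i} {f : Fin n → Var n} {s s' : Assignment n A} →
                        s (f i) ≡ s' (f i) → Agree (map f (others n i)) s s' →
                        ∀ j → s (f j) ≡ s' (f j)
  agree-others-and-at {i} eq agree j with j ≟ i
  ... | yes refl = eq
  ... | no j≢i = agree-others⁻ agree j j≢i

  agree-m̄λ⁺ : {s s' : Assignment n A} →
              (∀ j → s (m j) ≡ s' (m j)) → s lam ≡ s' lam → Agree (m̄λ n) s s'
  agree-m̄λ⁺ eqm eqλ = ++⁺ (agree-map⁺ (λ {j} _ → eqm j)) (eqλ ∷ [])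

  agree-m̄λ⁻ : {s s' : Assignment n A} →
              Agree (m̄λ n) s s' → (∀ j → s (m j) ≡ s' (m j)) × s lam ≡ s' lam
  agree-m̄λ⁻ agree with ++⁻ʳ (m̄ n) agree
  ... | eqλ ∷ [] = (λ j → agree-map⁻ (++⁻ˡ (m̄ n) agree) (∈-allFin j)) , eqλ

  OutputExchanged : Fin n → (s s' w : Assignment n A) → Set
  OutputExchanged i s s' w =
    (∀ j → w (m j) ≡ s' (m j)) × w lam ≡ s' lam ×
    w (o i) ≡ s (o i) × (∀ j → j ≢ i → w (o j) ≡ s' (o j))

  OutputExchange : Team n A → Set
  OutputExchange X =
    ∀ i {s s'} → X s → X s' → s (m i) ≡ s' (m i) → s lam ≡ s' lam →
    Σ _ λ w → X w × OutputExchanged i s s' w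

  module _ {X : Team n A} where

    Loc⇒OutputExchange : Loc X → OutputExchange X
    Loc⇒OutputExchange (out , par) i {s} {s'} Xs Xs' eqm eqλ
      with par i s s' Xs Xs' (eqm ∷ eqλ ∷ [])
    ... | v , Xv , (vm ∷ vλ ∷ []) , (vo ∷ []) , v≈s'
      with agree-others-and-at (trans vm eqm) v≈s'
    ... | vm≡s'm with out i v s' Xv Xs' (agree-m̄λ⁺ vm≡s'm (trans vλ eqλ))
    ... | w , Xw , w≈v , (wo ∷ []) , w≈s' =
      let (wm , wλ) = agree-m̄λ⁻ w≈v in
      w , Xw , (λ j → trans (wm j) (vm≡s'm j)) , trans wλ (trans vλ eqλ) ,
      trans wo vo , agree-others⁻ w≈s'

    OutputExchange⇒Star : OutputExchange X → Star X
    OutputExchange⇒Star exchange a c (t , Xt , tm , tλ) b _ sᵢ =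
      let (u , Xu , um , uλ , uo) = install (allFin n) in
      u , Xu , (λ i → um i , All.lookup uo (∈-allFin i)) , uλ
      where
      Installed : List (Fin n) → Set
      Installed is = Σ _ λ u → X u × (∀ j → u (m j) ≡ a j) × u lam ≡ c ×
                               All (λ j → u (o j) ≡ b j) is

      install : (is : List (Fin n)) → Installed is
      install [] = t , Xt , tm , tλ , []
      install (i ∷ is) with install is | sᵢ i
      ... | u , Xu , um , uλ , uo | s , Xs , sm , so , sλ
        with exchange i Xs Xu (trans sm (sym (um i))) (trans sλ (sym uλ))
      ... | w , Xw , wm , wλ , wo , wo₋ =
        w , Xw , (λ j → trans (wm j) (um j)) , trans wλ uλ ,
        trans wo so ∷ All.tabulate keep
        where
        keep : ∀ {j} → j ∈ is → w (o j) ≡ b j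
        keep {j} j∈ with j ≟ i
        ... | yes refl = trans wo so
        ... | no j≢i = trans (wo₋ j j≢i) (All.lookup uo j∈)

    Star⇒OutputExchange : Star X → OutputExchange X
    Star⇒OutputExchange star i {s} {s'} Xs Xs' eqm eqλ
      with star (λ j → s' (m j)) (s' lam) (s' , Xs' , (λ _ → refl) , refl)
                b (λ j → let (sⱼ , Xsⱼ , _ , sⱼo , _) = witness j in sⱼ , Xsⱼ , sⱼo) witness
      where
      b : Fin n → A
      b = updateAt (λ j → s' (o j)) i (λ _ → s (o i))
      witness : ∀ j → Σ _ λ sⱼ → X sⱼ × sⱼ (m j) ≡ s' (m j) × sⱼ (o j) ≡ b j × sⱼ lam ≡ s' lam
      witness j with j ≟ i
      ... | yes refl = s , Xs , eqm , sym (updateAt-updates i _) , eqλ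
      ... | no j≢i = s' , Xs' , refl , sym (updateAt-minimal j i _ j≢i) , refl
    ... | w , Xw , wmo , wλ =
      w , Xw , (λ j → wmo j .proj₁) , wλ ,
      trans (wmo i .proj₂) (updateAt-updates i _) ,
      λ j j≢i → trans (wmo j .proj₂) (updateAt-minimal j i _ j≢i)

    OutputExchange⇒OutIndep : OutputExchange X → OutIndep X
    OutputExchange⇒OutIndep exchange i s s' Xs Xs' s≈s'
      with agree-m̄λ⁻ s≈s'
    ... | eqm , eqλ with exchange i Xs Xs' (eqm i) eqλ
    ... | w , Xw , wm , wλ , wo , wo₋ =
      w , Xw , agree-m̄λ⁺ (λ j → trans (wm j) (sym (eqm j))) (trans wλ (sym eqλ)) ,
      wo ∷ [] , agree-others⁺ wo₋

    OutputExchange⇒ParIndep : OutputExchange X → ParIndep X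
    OutputExchange⇒ParIndep exchange i s s' Xs Xs' (eqm ∷ eqλ ∷ [])
      with exchange i Xs Xs' eqm eqλ
    ... | w , Xw , wm , wλ , wo , _ =
      w , Xw , trans (wm i) (sym eqm) ∷ trans wλ (sym eqλ) ∷ [] ,
      wo ∷ [] , agree-others⁺ (λ j _ → wm j)

lemma4p4 : {n : ℕ} {A : Set} → 1 ≤ n → (X : Team n A) → Loc X ⇔ Star X
lemma4p4 _ X = mk⇔
  (λ loc → OutputExchange⇒Star (Loc⇒OutputExchange loc))
  (λ star → let exchange = Star⇒OutputExchange star in
            OutputExchange⇒OutIndep exchange , OutputExchange⇒ParIndep exchange)
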